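{- The outerplanar graph $G_7=K_1+P_6$ has $\chi_{\mathrm{so}}(G_7)=7$.
   Context: $K_1+P_6$ is the join of a single vertex with the path $P_6$ on six vertices, i.e., the graph obtained from $P_6$ by adding one new vertex adjacent to all six path vertices. A strong odd coloring of a simple graph $G$ is a proper vertex coloring such that for every vertex $v$ and every color $c$, the number of neighbors of $v$ colored $c$ is either $0$ or odd. $\chi_{\mathrm{so}}(G)$ is the minimum number of colors in a strong odd coloring of $G$. -}

module Defs where

open import Data.Nat using (ℕ; zero; suc; _<_)
open import Data.Nat.Properties using (_≟_)
open import Data.Fin using (Fin; toℕ)
open import Data.Bool using (Bool; true; false; _∧_; _∨_; if_then_else_)
open import Data.List using (List; filterᵇ; length; allFin)
open import Data.Product using (_×_; Σ; ∃)
open import Data.Sum using (_⊎_)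
open import Relation.Binary.PropositionalEquality using (_≡_; _≢_)
open import Relation.Nullary using (¬_)
open import Relation.Nullary.Decidable using (⌊_⌋)
open import Data.Nat using (_≡ᵇ_)
open import Data.Nat.DivMod using (_%_)

Odd : ℕ → Set
Odd n = n % 2 ≡ 1

-- A finite simple graph on vertex set Fin n, given by a Boolean adjacency
-- function (intended symmetric and irreflexive).
record Graph (n : ℕ) : Set where
  field
    adj : Fin n → Fin n → Bool

open Graph public

_=ᶠ_ : ∀ {k} → Fin k → Fin k → Bool
a =ᶠ b = toℕ a ≡ᵇ toℕ b

nbrsColoured : ∀ {n k} → Graph n → (Fin n → Fin k) → Fin n → Fin k → ℕ
nbrsColoured G c v x = length (filterᵇ (λ u → adj G v u ∧ (c u =ᶠ x)) (allFin _))

IsProper : ∀ {n k} → Graph n → (Fin n → Fin k) → Set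
IsProper G c = ∀ u v → adj G u v ≡ true → c u ≢ c v

IsStrongOdd : ∀ {n k} → Graph n → (Fin n → Fin k) → Set
IsStrongOdd G c = IsProper G c × (∀ v x → nbrsColoured G c v x ≡ 0 ⊎ Odd (nbrsColoured G c v x))

HasStrongOddColouring : ∀ {n} → Graph n → ℕ → Set
HasStrongOddColouring {n} G k = Σ (Fin n → Fin k) (IsStrongOdd G)

χso≡ : ∀ {n} → Graph n → ℕ → Set
χso≡ G m = HasStrongOddColouring G m × (∀ k → k < m → ¬ HasStrongOddColouring G k)

pathAdj : ℕ → ℕ → Bool
pathAdj i j = (suc i ≡ᵇ j) ∨ (suc j ≡ᵇ i)

-- K_1 + P_6 on Fin 7: vertex 0 is the apex adjacent to all of 1..6,
-- and vertices 1..6 form the path 1-2-3-4-5-6.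
G7 : Graph 7
G7 = record { adj = λ u v → joinAdj (toℕ u) (toℕ v) }
  where
  joinAdj : ℕ → ℕ → Bool
  joinAdj zero zero = false
  joinAdj zero (suc _) = true
  joinAdj (suc _) zero = true
  joinAdj (suc i) (suc j) = pathAdj i j

-- The identity colouring is strong odd, since every vertex sees each colour
-- at most once. Conversely no vertex may see a colour exactly twice. Hence
-- path vertices at distance two get different colours (their common path
-- neighbour would see that colour twice, the apex having a colour of its
-- own), and then so do path vertices further apart (the apex would see their
-- common colour exactly twice). So a strong odd colouring of G7 is injective.
module Submission where

open import Defs
open import Data.Nat using (ℕ; zero; suc; _<_; _≟_; z<s; s<s)
open import Data.Nat.DivMod using (_%_)
open import Data.Nat.Properties using (≡ᵇ⇒≡; ≡⇒≡ᵇ)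
open import Data.Fin as Fin using (Fin; zero; suc; toℕ; #_)
open import Data.Fin.Properties using (toℕ-injective; pigeonhole; all?)
open import Data.Bool using (Bool; true; false; _∧_)
import Data.Bool.Properties as Bool
open import Data.List using (List; []; _∷_; filterᵇ; length; allFin; map)
open import Data.List.Relation.Binary.Pointwise using (Pointwise; []; _∷_; Pointwise-≡⇒≡)
open import Data.Product using (_,_; proj₁; proj₂)
open import Data.Sum using (_⊎_; inj₁; inj₂)
open import Function using (id; _∘_; Equivalence)
open import Relation.Binary.PropositionalEquality
open import Relation.Nullary using (¬_; Dec)
open import Relation.Nullary.Decidable using (_⊎-dec_; toWitness)

count : List Bool → ℕ
count bs = length (filterᵇ id bs)

length-filterᵇ : ∀ {A : Set} (p : A → Bool) xs → length (filterᵇ p xs) ≡ count (map p xs)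
length-filterᵇ p [] = refl
length-filterᵇ p (x ∷ xs) with p x
... | true = cong suc (length-filterᵇ p xs)
... | false = length-filterᵇ p xs

=ᶠ-refl : ∀ {k} (x : Fin k) → (x =ᶠ x) ≡ true
=ᶠ-refl x = Equivalence.to Bool.T-≡ (≡⇒≡ᵇ (toℕ x) _ refl)

≡⇒=ᶠ : ∀ {k} {x y : Fin k} → x ≡ y → (x =ᶠ y) ≡ true
≡⇒=ᶠ {x = x} refl = =ᶠ-refl x

≢⇒¬=ᶠ : ∀ {k} {x y : Fin k} → x ≢ y → (x =ᶠ y) ≡ false
≢⇒¬=ᶠ x≢y = Bool.¬-not (x≢y ∘ toℕ-injective ∘ ≡ᵇ⇒≡ _ _ ∘ Equivalence.from Bool.T-≡)

≢-≡⇒¬=ᶠ : ∀ {k} {u x y : Fin k} → u ≢ y → x ≡ y → (u =ᶠ x) ≡ false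
≢-≡⇒¬=ᶠ u≢y x≡y = ≢⇒¬=ᶠ (u≢y ∘ λ u≡x → trans u≡x x≡y)

zero-or-odd? : ∀ m → Dec (m ≡ 0 ⊎ Odd m)
zero-or-odd? m = (m ≟ 0) ⊎-dec (m % 2 ≟ 1)

¬zero-or-odd-2 : ¬ (2 ≡ 0 ⊎ Odd 2)
¬zero-or-odd-2 (inj₁ ())
¬zero-or-odd-2 (inj₂ ())

colourTests : ∀ {n k} → Graph n → (Fin n → Fin k) → Fin n → Fin k → List Bool
colourTests G c v x = map (λ u → adj G v u ∧ (c u =ᶠ x)) (allFin _)

module _ {n k} {G : Graph n} {c : Fin n → Fin k} (so : IsStrongOdd G c) where

  nbrsColoured≢2 : ∀ v x → nbrsColoured G c v x ≢ 2
  nbrsColoured≢2 v x eq = ¬zero-or-odd-2 (subst (λ m → m ≡ 0 ⊎ Odd m) eq (proj₂ so v x))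

  count-colourTests≢2 : ∀ v x {bs} → Pointwise _≡_ (colourTests G c v x) bs → count bs ≢ 2
  count-colourTests≢2 v x {bs} tests≡bs count≡2 = nbrsColoured≢2 v x (begin
    nbrsColoured G c v x         ≡⟨ length-filterᵇ _ (allFin n) ⟩
    count (colourTests G c v x)  ≡⟨ cong count (Pointwise-≡⇒≡ tests≡bs) ⟩
    count bs                     ≡⟨ count≡2 ⟩
    2                            ∎)
    where open ≡-Reasoning

G7-irreflexive : ∀ u → adj G7 u u ≡ false
G7-irreflexive = toWitness {a? = all? λ u → adj G7 u u Bool.≟ false} _

id-strongOdd : IsStrongOdd G7 id
id-strongOdd = proper , toWitness {a? = all? λ v → all? λ x → zero-or-odd? (nbrsColoured G7 id v x)} _
  where
  proper : IsProper G7 id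
  proper u .u u~u refl with () ← trans (sym u~u) (G7-irreflexive u)

-- In the calls to count-colourTests≢2 below the tests are listed vertex by
-- vertex; the entries of non-neighbours of the chosen vertex compute to false.
module _ {k} {c : Fin 7 → Fin k} (so : IsStrongOdd G7 c) where
  private
    adjacent : ∀ u v → adj G7 u v ≡ true → c u ≢ c v
    adjacent = proj₁ so

    c₀≢ : ∀ j → c zero ≢ c (suc j)
    c₀≢ j = adjacent zero (suc j) refl

    c₁≢c₂ : c (# 1) ≢ c (# 2)
    c₁≢c₂ = adjacent (# 1) (# 2) refl

    c₂≢c₃ : c (# 2) ≢ c (# 3)
    c₂≢c₃ = adjacent (# 2) (# 3) refl

    c₃≢c₄ : c (# 3) ≢ c (# 4)
    c₃≢c₄ = adjacent (# 3) (# 4) refl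

    c₄≢c₅ : c (# 4) ≢ c (# 5)
    c₄≢c₅ = adjacent (# 4) (# 5) refl

    c₅≢c₆ : c (# 5) ≢ c (# 6)
    c₅≢c₆ = adjacent (# 5) (# 6) refl

    c₁≢c₃ : c (# 1) ≢ c (# 3)
    c₁≢c₃ e = count-colourTests≢2 so (# 2) (c (# 1))
      (≢⇒¬=ᶠ (c₀≢ _) ∷ =ᶠ-refl (c (# 1)) ∷ refl ∷ ≡⇒=ᶠ (sym e) ∷ refl ∷ refl ∷ refl ∷ []) refl

    c₂≢c₄ : c (# 2) ≢ c (# 4)
    c₂≢c₄ e = count-colourTests≢2 so (# 3) (c (# 2))
      (≢⇒¬=ᶠ (c₀≢ _) ∷ refl ∷ =ᶠ-refl (c (# 2)) ∷ refl ∷ ≡⇒=ᶠ (sym e) ∷ refl ∷ refl ∷ []) refl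

    c₃≢c₅ : c (# 3) ≢ c (# 5)
    c₃≢c₅ e = count-colourTests≢2 so (# 4) (c (# 3))
      (≢⇒¬=ᶠ (c₀≢ _) ∷ refl ∷ refl ∷ =ᶠ-refl (c (# 3)) ∷ refl ∷ ≡⇒=ᶠ (sym e) ∷ refl ∷ []) refl

    c₄≢c₆ : c (# 4) ≢ c (# 6)
    c₄≢c₆ e = count-colourTests≢2 so (# 5) (c (# 4))
      (≢⇒¬=ᶠ (c₀≢ _) ∷ refl ∷ refl ∷ refl ∷ =ᶠ-refl (c (# 4)) ∷ refl ∷ ≡⇒=ᶠ (sym e) ∷ []) refl

    c₁≢c₄ : c (# 1) ≢ c (# 4)
    c₁≢c₄ e = count-colourTests≢2 so (# 0) (c (# 1))
      (refl ∷ =ᶠ-refl (c (# 1)) ∷ ≢⇒¬=ᶠ (≢-sym c₁≢c₂) ∷ ≢⇒¬=ᶠ (≢-sym c₁≢c₃) ∷ ≡⇒=ᶠ (sym e)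
        ∷ ≢-≡⇒¬=ᶠ (≢-sym c₄≢c₅) e ∷ ≢-≡⇒¬=ᶠ (≢-sym c₄≢c₆) e ∷ []) refl

    c₁≢c₅ : c (# 1) ≢ c (# 5)
    c₁≢c₅ e = count-colourTests≢2 so (# 0) (c (# 1))
      (refl ∷ =ᶠ-refl (c (# 1)) ∷ ≢⇒¬=ᶠ (≢-sym c₁≢c₂) ∷ ≢⇒¬=ᶠ (≢-sym c₁≢c₃) ∷ ≢⇒¬=ᶠ (≢-sym c₁≢c₄)
        ∷ ≡⇒=ᶠ (sym e) ∷ ≢-≡⇒¬=ᶠ (≢-sym c₅≢c₆) e ∷ []) refl

    c₁≢c₆ : c (# 1) ≢ c (# 6)
    c₁≢c₆ e = count-colourTests≢2 so (# 0) (c (# 1))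
      (refl ∷ =ᶠ-refl (c (# 1)) ∷ ≢⇒¬=ᶠ (≢-sym c₁≢c₂) ∷ ≢⇒¬=ᶠ (≢-sym c₁≢c₃) ∷ ≢⇒¬=ᶠ (≢-sym c₁≢c₄)
        ∷ ≢⇒¬=ᶠ (≢-sym c₁≢c₅) ∷ ≡⇒=ᶠ (sym e) ∷ []) refl

    c₂≢c₅ : c (# 2) ≢ c (# 5)
    c₂≢c₅ e = count-colourTests≢2 so (# 0) (c (# 2))
      (refl ∷ ≢⇒¬=ᶠ c₁≢c₂ ∷ =ᶠ-refl (c (# 2)) ∷ ≢⇒¬=ᶠ (≢-sym c₂≢c₃) ∷ ≢⇒¬=ᶠ (≢-sym c₂≢c₄)
        ∷ ≡⇒=ᶠ (sym e) ∷ ≢-≡⇒¬=ᶠ (≢-sym c₅≢c₆) e ∷ []) refl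

    c₂≢c₆ : c (# 2) ≢ c (# 6)
    c₂≢c₆ e = count-colourTests≢2 so (# 0) (c (# 2))
      (refl ∷ ≢⇒¬=ᶠ c₁≢c₂ ∷ =ᶠ-refl (c (# 2)) ∷ ≢⇒¬=ᶠ (≢-sym c₂≢c₃) ∷ ≢⇒¬=ᶠ (≢-sym c₂≢c₄)
        ∷ ≢⇒¬=ᶠ (≢-sym c₂≢c₅) ∷ ≡⇒=ᶠ (sym e) ∷ []) refl

    c₃≢c₆ : c (# 3) ≢ c (# 6)
    c₃≢c₆ e = count-colourTests≢2 so (# 0) (c (# 3))
      (refl ∷ ≢⇒¬=ᶠ c₁≢c₃ ∷ ≢⇒¬=ᶠ c₂≢c₃ ∷ =ᶠ-refl (c (# 3)) ∷ ≢⇒¬=ᶠ (≢-sym c₃≢c₄)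
        ∷ ≢⇒¬=ᶠ (≢-sym c₃≢c₅) ∷ ≡⇒=ᶠ (sym e) ∷ []) refl

  strongOdd-injective : ∀ {i j} → i Fin.< j → c i ≢ c j
  strongOdd-injective {zero} {suc j} _ = c₀≢ j
  strongOdd-injective {suc zero} {suc (suc zero)} (s<s z<s) = c₁≢c₂
  strongOdd-injective {suc zero} {suc (suc (suc zero))} (s<s z<s) = c₁≢c₃
  strongOdd-injective {suc zero} {suc (suc (suc (suc zero)))} (s<s z<s) = c₁≢c₄
  strongOdd-injective {suc zero} {suc (suc (suc (suc (suc zero))))} (s<s z<s) = c₁≢c₅
  strongOdd-injective {suc zero} {suc (suc (suc (suc (suc (suc zero)))))} (s<s z<s) = c₁≢c₆
  strongOdd-injective {suc (suc zero)} {suc (suc (suc zero))} (s<s (s<s z<s)) = c₂≢c₃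
  strongOdd-injective {suc (suc zero)} {suc (suc (suc (suc zero)))} (s<s (s<s z<s)) = c₂≢c₄
  strongOdd-injective {suc (suc zero)} {suc (suc (suc (suc (suc zero))))} (s<s (s<s z<s)) = c₂≢c₅
  strongOdd-injective {suc (suc zero)} {suc (suc (suc (suc (suc (suc zero)))))} (s<s (s<s z<s)) = c₂≢c₆
  strongOdd-injective {suc (suc (suc zero))} {suc (suc (suc (suc zero)))} (s<s (s<s (s<s z<s))) = c₃≢c₄
  strongOdd-injective {suc (suc (suc zero))} {suc (suc (suc (suc (suc zero))))} (s<s (s<s (s<s z<s))) = c₃≢c₅
  strongOdd-injective {suc (suc (suc zero))} {suc (suc (suc (suc (suc (suc zero)))))} (s<s (s<s (s<s z<s))) = c₃≢c₆
  strongOdd-injective {suc (suc (suc (suc zero)))} {suc (suc (suc (suc (suc zero))))} (s<s (s<s (s<s (s<s z<s)))) = c₄≢c₅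
  strongOdd-injective {suc (suc (suc (suc zero)))} {suc (suc (suc (suc (suc (suc zero)))))} (s<s (s<s (s<s (s<s z<s)))) = c₄≢c₆
  strongOdd-injective {suc (suc (suc (suc (suc zero))))} {suc (suc (suc (suc (suc (suc zero)))))} (s<s (s<s (s<s (s<s (s<s z<s))))) = c₅≢c₆

  strongOdd⇒¬colours<7 : ¬ k < 7
  strongOdd⇒¬colours<7 k<7 with i , j , i<j , cᵢ≡cⱼ ← pigeonhole k<7 c = strongOdd-injective i<j cᵢ≡cⱼ

proposition3p2 : χso≡ G7 7
proposition3p2 = (id , id-strongOdd) , λ k k<7 (c , so) → strongOdd⇒¬colours<7 so k<7
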